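{- Let $\ell\geqslant 0$, $n\geqslant \ell+1$ and $k\geqslant 2$ be integers. Then $|\mathcal{E}_{n,\ell+1,k}|=|\mathcal{F}_{n,\ell,k+1}|$.
   Context: For $\ell\geqslant 0$, a finite set $A\subset\mathbb{N}$ is $\ell$-strong Schreier if $A=\emptyset$ or $\min A\geqslant \ell|A|-\ell+1$. A set $A=\{a_1<\cdots<a_n\}\subset\mathbb{N}$ is sparse if $|A|\leqslant 2$, or $|A|\geqslant 3$ and $a_i-a_{i-1}\geqslant a_{i-1}-a_{i-2}$ for $3\leqslant i\leqslant n$. $\mathcal{F}_{n,\ell}$ is the collection of sets of positive integers $A=\{a_1,\ldots,a_p,n+1\}$ such that (i) $p\geqslant 2$ and $a_1<\cdots<a_p<n+1$; (ii) $A$ is sparse and $\ell$-strong Schreier; (iii) $n+1+a_{p-1}=2a_p$. $\mathcal{F}_{n,\ell,k}$ consists of the sets in $\mathcal{F}_{n,\ell}$ with exactly $k$ elements. $\mathcal{E}_{n,\ell,k}$ is the set of partitions of $n$ into exactly $k$ parts, each at least $\ell$. -}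

module Defs where

open import Data.Nat using (ℕ; zero; suc; _+_; _*_; _∸_; _≤ᵇ_; _≡ᵇ_)
open import Data.Bool using (Bool; true; false; _∧_)
open import Data.List using (List; []; _∷_; _++_; map; length; filter; upTo; concatMap)
open import Data.Nat.ListAction using (sum)
open import Relation.Nullary.Decidable using (Dec)
open import Data.Bool.Properties using (T?)
open import Data.Bool using (T)

-- Finite sets of positive integers are represented as strictly increasing lists.
-- Partitions are represented as weakly decreasing lists of parts.

range1 : ℕ → List ℕ
range1 n = map suc (upTo n)

-- all sublists (order preserved); applied to a strictly increasing list this
-- enumerates every subset exactly once, each as an increasing list
sublists : List ℕ → List (List ℕ)
sublists [] = [] ∷ []
sublists (x ∷ xs) = map (x ∷_) (sublists xs) ++ sublists xs

tuples : ℕ → List ℕ → List (List ℕ)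
tuples zero xs = [] ∷ []
tuples (suc k) xs = concatMap (λ x → map (x ∷_) (tuples k xs)) xs

sparse : List ℕ → Bool
sparse (x ∷ y ∷ z ∷ r) = ((y ∸ x) ≤ᵇ (z ∸ y)) ∧ sparse (y ∷ z ∷ r)
sparse _ = true

strongSchreier : ℕ → List ℕ → Bool
strongSchreier ℓ [] = true
strongSchreier ℓ A@(a ∷ _) = ((ℓ * length A ∸ ℓ) + 1) ≤ᵇ a

lastTwoCond : ℕ → List ℕ → Bool
lastTwoCond n (x ∷ y ∷ []) = (suc n + x) ≡ᵇ (2 * y)
lastTwoCond n (x ∷ y ∷ z ∷ r) = lastTwoCond n (y ∷ z ∷ r)
lastTwoCond n _ = false

-- membership test for F_{n,ℓ,k}, where the set is A = S ∪ {n+1}, S ⊆ {1..n} increasing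
inF : ℕ → ℕ → ℕ → List ℕ → Bool
inF n ℓ k S =
  (2 ≤ᵇ length S) ∧ sparse (S ++ (suc n ∷ [])) ∧ strongSchreier ℓ (S ++ (suc n ∷ []))
  ∧ lastTwoCond n S ∧ (length (S ++ (suc n ∷ [])) ≡ᵇ k)

-- every member of F_{n,ℓ} has the form S ∪ {n+1} with S ⊆ {1,…,n} (positive, < n+1)
-- the family F_{n,ℓ,k} listed via the sets S (A = S ++ [n+1])
Fnlk : ℕ → ℕ → ℕ → List (List ℕ)
Fnlk n ℓ k = filter (λ S → T? (inF n ℓ k S)) (sublists (range1 n))

nonincreasing : List ℕ → Bool
nonincreasing (x ∷ y ∷ r) = (y ≤ᵇ x) ∧ nonincreasing (y ∷ r)
nonincreasing _ = true

allGeq : ℕ → List ℕ → Bool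
allGeq ℓ [] = true
allGeq ℓ (x ∷ xs) = (ℓ ≤ᵇ x) ∧ allGeq ℓ xs

isPart : ℕ → ℕ → ℕ → List ℕ → Bool
isPart n ℓ k P = nonincreasing P ∧ allGeq ℓ P ∧ (sum P ≡ᵇ n) ∧ (length P ≡ᵇ k)

-- E_{n,ℓ,k}: every part of a partition of n lies in {1..n}, so candidate lists
-- of length k over {1..n} cover all partitions of n (for n ≥ 1) into k parts
Enlk : ℕ → ℕ → ℕ → List (List ℕ)
Enlk n ℓ k = filter (λ P → T? (isPart n ℓ k P)) (tuples k (range1 n))

-- Write a set A = {a₁ < ⋯ < a_k < n + 1} of F_{n,ℓ,k+1} through its minimum a = a₁ and
-- its gaps g₁, …, g_k. Sparseness says g₁ ≤ ⋯ ≤ g_k, condition (iii) says g_{k-1} = g_k =: d, the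
-- Schreier condition says a ≥ ℓk + 1, and a + Σ gᵢ = n + 1. Hence
--   (a − (ℓk + 1) + ℓ + d, ℓ + d, ℓ + g_{k-2}, …, ℓ + g₁)
-- is a partition of n into k parts, all at least ℓ + 1. Conversely a partition (p, t, t₃, …, t_k)
-- comes from exactly one set: the one with minimum p − t + ℓk + 1 whose gaps, read downwards from
-- n + 1, are t − ℓ, t − ℓ, t₃ − ℓ, …, t_k − ℓ. Both families are enumerated without repetitions, so
-- this bijection equates their lengths.

module Submission where

open import Defs
open import Data.Bool using (T)
open import Data.Bool.Properties using (T-∧; T?)
open import Data.Empty using (⊥-elim)
open import Data.List using (List; []; _∷_; _∷ʳ_; map; length; reverse; applyUpTo)
open import Data.List.Base using (reverseAcc)
open import Data.List.Properties
  using (length-map; length-++; length-reverse; map-∘; map-cong; map-id; map-id-local; map-applyUpTo;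
         unfold-reverse; reverse-involutive; ∷-injectiveˡ; ∷-injectiveʳ)
open import Data.List.Membership.Propositional using (_∈_)
open import Data.List.Membership.Propositional.Properties
  using (∈-map⁺; ∈-map⁻; ∈-++⁺ˡ; ∈-++⁺ʳ; ∈-++⁻; ∈-concatMap⁺; ∈-upTo⁺; ∈-filter⁺; ∈-filter⁻)
open import Data.List.Membership.Propositional.Properties.WithK using (unique∧set⇒bag)
open import Data.List.Relation.Binary.BagAndSetEquality using (∼bag⇒↭)
open import Data.List.Relation.Binary.Disjoint.Propositional using (Disjoint)
open import Data.List.Relation.Binary.Permutation.Propositional using (↭-sym)
open import Data.List.Relation.Binary.Permutation.Propositional.Properties using (↭-length; ↭-reverse; All-resp-↭)
open import Data.List.Relation.Binary.Subset.Propositional using (_⊆_)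
open import Data.List.Relation.Unary.All as All using (All; []; _∷_)
import Data.List.Relation.Unary.All.Properties as All
open import Data.List.Relation.Unary.AllPairs as AllPairs using ([]; _∷_)
import Data.List.Relation.Unary.AllPairs.Properties as AllPairs
open import Data.List.Relation.Unary.Any as Any using (here; there)
open import Data.List.Relation.Unary.Linked as Linked using (Linked; []; [-]; _∷_)
import Data.List.Relation.Unary.Linked.Properties as Linkedₚ
open import Data.List.Relation.Unary.Unique.Propositional using (Unique)
import Data.List.Relation.Unary.Unique.Propositional.Properties as Unique
open import Data.Nat using (ℕ; zero; suc; _+_; _*_; _∸_; _≤_; _<_; _≥_; _≤ᵇ_; _≡ᵇ_; z≤n; s≤s)
open import Data.Nat.ListAction using (sum)
open import Data.Nat.ListAction.Properties using (sum-↭)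
open import Data.Nat.Properties
open import Data.Nat.Tactic.RingSolver using (solve-∀)
open import Data.Product using (Σ; _×_; _,_; proj₂)
open import Data.Sum using (inj₁; inj₂)
open import Function using (flip; _∘_; _⇔_; mk⇔; Equivalence)
open import Function.Construct.Composition using (_⇔-∘_)
open import Relation.Binary.PropositionalEquality

open Equivalence using (to; from)

length-≡-by-inverses : ∀ {A B : Set} {xs : List A} {ys : List B} →
  Unique xs → Unique ys → (f : A → B) (g : B → A) →
  (∀ {x} → x ∈ xs → f x ∈ ys) → (∀ {y} → y ∈ ys → g y ∈ xs) →
  (∀ {x} → x ∈ xs → g (f x) ≡ x) → (∀ {y} → y ∈ ys → f (g y) ≡ y) →
  length xs ≡ length ys
length-≡-by-inverses {xs = xs} {ys} xs! ys! f g f∈ g∈ gf fg = begin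
  length xs          ≡⟨ length-map f xs ⟨
  length (map f xs)  ≡⟨ ↭-length (∼bag⇒↭ (unique∧set⇒bag fxs! ys! fxs≈ys)) ⟩
  length ys          ∎
  where
  open ≡-Reasoning
  gfxs≡xs : map g (map f xs) ≡ xs
  gfxs≡xs = trans (sym (map-∘ {g = g} {f = f} xs)) (map-id-local (All.tabulate gf))
  fxs! : Unique (map f xs)
  fxs! = Unique.map⁻ {f = g} (subst Unique (sym gfxs≡xs) xs!)
  fxs≈ys : ∀ {y} → (y ∈ map f xs) ⇔ (y ∈ ys)
  fxs≈ys = mk⇔ (λ y∈ → let x , x∈ , y≡ = ∈-map⁻ f y∈ in subst (_∈ ys) (sym y≡) (f∈ x∈))
               (λ y∈ → subst (_∈ map f xs) (fg y∈) (∈-map⁺ f (g∈ y∈)))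

module _ {A : Set} {R : A → A → Set} where

  Linked-reverse : ∀ {xs} → Linked R xs → Linked (flip R) (reverse xs)
  Linked-reverse []              = []
  Linked-reverse {x ∷ xs} Rx∷xs = go xs [] Rx∷xs [-]
    where
    go : ∀ {x} ys acc → Linked R (x ∷ ys) → Linked (flip R) (x ∷ acc) →
         Linked (flip R) (reverseAcc (x ∷ acc) ys)
    go []       acc _           Racc = Racc
    go (y ∷ ys) acc (Rxy ∷ Rys) Racc = go ys _ Rys (Rxy ∷ Racc)

  Linked-∷ʳ⁻ : ∀ {xs y} → Linked R (xs ∷ʳ y) → Linked R xs
  Linked-∷ʳ⁻ {[]}         _           = []
  Linked-∷ʳ⁻ {_ ∷ []}     _           = [-]
  Linked-∷ʳ⁻ {_ ∷ _ ∷ _}  (Rxy ∷ Rxs) = Rxy ∷ Linked-∷ʳ⁻ Rxs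

Linked-<-last : ∀ {x h} xs → Linked _<_ (x ∷ xs ∷ʳ h) → x < h
Linked-<-last xs Rx∷xs = proj₂ (All.∷ʳ⁻ (AllPairs.head (Linkedₚ.Linked⇒AllPairs <-trans Rx∷xs)))

Linked-<-lowerHead : ∀ {x y xs} → y ≤ x → Linked _<_ (x ∷ xs) → Linked _<_ (y ∷ xs)
Linked-<-lowerHead y≤x [-]         = [-]
Linked-<-lowerHead y≤x (x<z ∷ Rxs) = ≤-<-trans y≤x x<z ∷ Rxs

All-reverse : ∀ {P : ℕ → Set} {xs} → All P xs → All P (reverse xs)
All-reverse {xs = xs} = All-resp-↭ (↭-sym (↭-reverse xs))

sum-reverse : ∀ xs → sum (reverse xs) ≡ sum xs
sum-reverse xs = sum-↭ (↭-reverse xs)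

parts-≤-sum : ∀ xs → All (_≤ sum xs) xs
parts-≤-sum []       = []
parts-≤-sum (x ∷ xs) =
  m≤m+n x (sum xs) ∷ All.map (λ y≤ → ≤-trans y≤ (m≤n+m (sum xs) x)) (parts-≤-sum xs)

sum-map-+ : ∀ ℓ xs → sum (map (ℓ +_) xs) ≡ ℓ * length xs + sum xs
sum-map-+ ℓ []       = sym (cong (_+ 0) (*-zeroʳ ℓ))
sum-map-+ ℓ (x ∷ xs) = begin
  ℓ + x + sum (map (ℓ +_) xs)       ≡⟨ cong (ℓ + x +_) (sum-map-+ ℓ xs) ⟩
  ℓ + x + (ℓ * length xs + sum xs)  ≡⟨ regroup ℓ x (ℓ * length xs) (sum xs) ⟩
  ℓ + ℓ * length xs + (x + sum xs)  ≡⟨ cong (_+ (x + sum xs)) (sym (*-suc ℓ (length xs))) ⟩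
  ℓ * suc (length xs) + (x + sum xs) ∎
  where
  open ≡-Reasoning
  regroup : ∀ a b c e → a + b + (c + e) ≡ a + c + (b + e)
  regroup = solve-∀

map-+-∸ : ∀ ℓ {xs} → All (ℓ ≤_) xs → map (ℓ +_) (map (_∸ ℓ) xs) ≡ xs
map-+-∸ ℓ {xs} ℓ≤xs = trans (sym (map-∘ xs)) (map-id-local (All.map m+[n∸m]≡n ℓ≤xs))

map-∸-+ : ∀ ℓ xs → map (_∸ ℓ) (map (ℓ +_) xs) ≡ xs
map-∸-+ ℓ xs = trans (sym (map-∘ xs)) (trans (map-cong (m+n∸m≡n ℓ) xs) (map-id xs))

midpoint⇔ : ∀ x d N → N + x ≡ 2 * (x + d) ⇔ x + d + d ≡ N
midpoint⇔ x d N = mk⇔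
  (λ eq → sym (+-cancelʳ-≡ x N (x + d + d) (trans eq (double x d))))
  (λ { refl → sym (double x d) })
  where
  double : ∀ x d → 2 * (x + d) ≡ x + d + d + x
  double = solve-∀

[]∈sublists : ∀ (xs : List ℕ) → [] ∈ sublists xs
[]∈sublists []       = here refl
[]∈sublists (x ∷ xs) = ∈-++⁺ʳ _ ([]∈sublists xs)

sublists-⊆ : ∀ {xs ys : List ℕ} → ys ∈ sublists xs → ys ⊆ xs
sublists-⊆ {[]}     (here refl) ()
sublists-⊆ {x ∷ xs} ys∈ with ∈-++⁻ (map (x ∷_) (sublists xs)) ys∈
... | inj₂ ys∈′ = there ∘ sublists-⊆ ys∈′
... | inj₁ x∷ys∈ with ∈-map⁻ (x ∷_) x∷ys∈
...   | ys′ , ys′∈ , refl = λ { (here refl) → here refl ; (there z∈) → there (sublists-⊆ ys′∈ z∈) }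

Unique-sublists : ∀ {xs : List ℕ} → Unique xs → Unique (sublists xs)
Unique-sublists {[]}     []          = [] ∷ []
Unique-sublists {x ∷ xs} (x∉xs ∷ xs!) =
  Unique.++⁺ (Unique.map⁺ ∷-injectiveʳ (Unique-sublists xs!)) (Unique-sublists xs!) disjoint
  where
  disjoint : Disjoint (map (x ∷_) (sublists xs)) (sublists xs)
  disjoint (ys∈ , ys∈′) with ∈-map⁻ (x ∷_) ys∈
  ... | _ , _ , refl = All.lookup x∉xs (sublists-⊆ ys∈′ (here refl)) refl

between : ℕ → ℕ → List ℕ
between lo zero    = []
between lo (suc m) = suc lo ∷ between (suc lo) m

applyUpTo-between : ∀ {f : ℕ → ℕ} lo m → (∀ i → f i ≡ suc (lo + i)) → applyUpTo f m ≡ between lo m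
applyUpTo-between lo zero    _  = refl
applyUpTo-between lo (suc m) f≗ = cong₂ _∷_
  (trans (f≗ 0) (cong suc (+-identityʳ lo)))
  (applyUpTo-between (suc lo) m (λ i → trans (f≗ (suc i)) (cong suc (+-suc lo i))))

range1≡between : ∀ n → range1 n ≡ between 0 n
range1≡between n = trans (map-applyUpTo (λ i → i) suc n) (applyUpTo-between 0 n (λ _ → refl))

∈-sublists-between⁻ : ∀ lo m {S} → S ∈ sublists (between lo m) → Linked _<_ (lo ∷ S ∷ʳ suc (lo + m))
∈-sublists-between⁻ lo zero    (here refl) = s≤s (m≤m+n lo 0) ∷ [-]
∈-sublists-between⁻ lo (suc m) S∈ rewrite +-suc lo m
  with ∈-++⁻ (map (suc lo ∷_) (sublists (between (suc lo) m))) S∈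
... | inj₁ S∈ˡ with ∈-map⁻ (suc lo ∷_) S∈ˡ
...   | S′ , S′∈ , refl = ≤-refl ∷ ∈-sublists-between⁻ (suc lo) m S′∈
∈-sublists-between⁻ lo (suc m) S∈ | inj₂ S∈ʳ =
  Linked-<-lowerHead (n≤1+n lo) (∈-sublists-between⁻ (suc lo) m S∈ʳ)

∈-sublists-between⁺ : ∀ lo m {S} → Linked _<_ (lo ∷ S ∷ʳ suc (lo + m)) → S ∈ sublists (between lo m)
∈-sublists-between⁺ lo m       {[]}    _           = []∈sublists (between lo m)
∈-sublists-between⁺ lo zero    {x ∷ S} (lo<x ∷ Rx) =
  ⊥-elim (<⇒≱ lo<x (subst (x ≤_) (+-identityʳ lo) (≤-pred (Linked-<-last S Rx))))
∈-sublists-between⁺ lo (suc m) {x ∷ S} (lo<x ∷ Rx) rewrite +-suc lo m with m≤n⇒m<n∨m≡n lo<x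
... | inj₂ refl  = ∈-++⁺ˡ (∈-map⁺ (suc lo ∷_) (∈-sublists-between⁺ (suc lo) m Rx))
... | inj₁ lo<′x = ∈-++⁺ʳ _ (∈-sublists-between⁺ (suc lo) m (lo<′x ∷ Rx))

∈-sublists-range1⇔ : ∀ n {S} → S ∈ sublists (range1 n) ⇔ Linked _<_ (0 ∷ S ∷ʳ suc n)
∈-sublists-range1⇔ n rewrite range1≡between n =
  mk⇔ (∈-sublists-between⁻ 0 n) (∈-sublists-between⁺ 0 n)

Unique-range1 : ∀ n → Unique (range1 n)
Unique-range1 n = Unique.map⁺ suc-injective (Unique.upTo⁺ n)

∈-range1⁺ : ∀ {n x} → 0 < x → x ≤ n → x ∈ range1 n
∈-range1⁺ {x = suc x} _ x<n = ∈-map⁺ suc (∈-upTo⁺ x<n)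

∈-tuples : ∀ {xs ys : List ℕ} → All (_∈ xs) ys → ys ∈ tuples (length ys) xs
∈-tuples []            = here refl
∈-tuples (y∈xs ∷ ys∈) = ∈-concatMap⁺ _ (Any.map (λ { refl → ∈-map⁺ _ (∈-tuples ys∈) }) y∈xs)

Unique-tuples : ∀ k {xs : List ℕ} → Unique xs → Unique (tuples k xs)
Unique-tuples zero    _   = [] ∷ []
Unique-tuples (suc k) xs! =
  Unique.concat⁺ (All.map⁺ (All.universal (λ _ → Unique.map⁺ ∷-injectiveʳ (Unique-tuples k xs!)) _))
                 (AllPairs.map⁺ (AllPairs.map disjoint xs!))
  where
  disjoint : ∀ {x y} → x ≢ y → Disjoint (map (x ∷_) (tuples k _)) (map (y ∷_) (tuples k _))
  disjoint x≢y (v∈ , v∈′) with ∈-map⁻ _ v∈ | ∈-map⁻ _ v∈′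
  ... | _ , _ , refl | _ , _ , eq = x≢y (∷-injectiveˡ eq)

-- Gap sequences

fromGaps : ℕ → List ℕ → List ℕ
fromGaps a []       = []
fromGaps a (g ∷ gs) = a + g ∷ fromGaps (a + g) gs

gaps : ℕ → List ℕ → List ℕ
gaps a []       = []
gaps a (x ∷ xs) = x ∸ a ∷ gaps x xs

gaps-fromGaps : ∀ a gs → gaps a (fromGaps a gs) ≡ gs
gaps-fromGaps a []       = refl
gaps-fromGaps a (g ∷ gs) = cong₂ _∷_ (m+n∸m≡n a g) (gaps-fromGaps (a + g) gs)

fromGaps-gaps : ∀ {a xs} → Linked _≤_ (a ∷ xs) → fromGaps a (gaps a xs) ≡ xs
fromGaps-gaps [-]         = refl
fromGaps-gaps (a≤x ∷ Rxs) rewrite m+[n∸m]≡n a≤x = cong (_ ∷_) (fromGaps-gaps Rxs)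

gaps-positive : ∀ {a xs} → Linked _<_ (a ∷ xs) → All (0 <_) (gaps a xs)
gaps-positive [-]         = []
gaps-positive (a<x ∷ Rxs) = m<n⇒0<n∸m a<x ∷ gaps-positive Rxs

fromGaps-increasing : ∀ a {gs} → All (0 <_) gs → Linked _<_ (a ∷ fromGaps a gs)
fromGaps-increasing a []           = [-]
fromGaps-increasing a (0<g ∷ 0<gs) = m<m+n a 0<g ∷ fromGaps-increasing _ 0<gs

fromGaps-∷ʳ : ∀ a gs g → fromGaps a (gs ∷ʳ g) ≡ fromGaps a gs ∷ʳ (a + sum gs + g)
fromGaps-∷ʳ a []       g = cong (λ b → b + g ∷ []) (sym (+-identityʳ a))
fromGaps-∷ʳ a (h ∷ gs) g = cong (a + h ∷_) (trans (fromGaps-∷ʳ (a + h) gs g)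
  (cong (λ b → fromGaps (a + h) gs ∷ʳ (b + g)) (+-assoc a h (sum gs))))

length-fromGaps : ∀ a gs → length (fromGaps a gs) ≡ length gs
length-fromGaps a []       = refl
length-fromGaps a (g ∷ gs) = cong suc (length-fromGaps (a + g) gs)

T-≡ᵇ : ∀ {m n} → T (m ≡ᵇ n) ⇔ m ≡ n
T-≡ᵇ = mk⇔ (≡ᵇ⇒≡ _ _) (≡⇒≡ᵇ _ _)

T-nonincreasing : ∀ {xs} → T (nonincreasing xs) ⇔ Linked _≥_ xs
T-nonincreasing = mk⇔ (⇒ _) (⇐ _)
  where
  ⇒ : ∀ xs → T (nonincreasing xs) → Linked _≥_ xs
  ⇒ []           _ = []
  ⇒ (x ∷ [])     _ = [-]
  ⇒ (x ∷ y ∷ xs) t = let ≤ᵇ , t′ = to T-∧ t in ≤ᵇ⇒≤ _ _ ≤ᵇ ∷ ⇒ (y ∷ xs) t′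
  ⇐ : ∀ xs → Linked _≥_ xs → T (nonincreasing xs)
  ⇐ []           _         = _
  ⇐ (x ∷ [])     _         = _
  ⇐ (x ∷ y ∷ xs) (≥ ∷ Rxs) = from T-∧ (≤⇒≤ᵇ ≥ , ⇐ (y ∷ xs) Rxs)

T-allGeq : ∀ {m xs} → T (allGeq m xs) ⇔ All (m ≤_) xs
T-allGeq = mk⇔ (⇒ _) (⇐ _)
  where
  ⇒ : ∀ xs → T (allGeq _ xs) → All (_ ≤_) xs
  ⇒ []       _ = []
  ⇒ (x ∷ xs) t = let ≤ᵇ , t′ = to T-∧ t in ≤ᵇ⇒≤ _ _ ≤ᵇ ∷ ⇒ xs t′
  ⇐ : ∀ xs → All (_ ≤_) xs → T (allGeq _ xs)
  ⇐ []       []         = _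
  ⇐ (x ∷ xs) (m≤x ∷ ms) = from T-∧ (≤⇒≤ᵇ m≤x , ⇐ xs ms)

T-sparse : ∀ {a xs} → T (sparse (a ∷ xs)) ⇔ Linked _≤_ (gaps a xs)
T-sparse = mk⇔ (⇒ _ _) (⇐ _ _)
  where
  ⇒ : ∀ a xs → T (sparse (a ∷ xs)) → Linked _≤_ (gaps a xs)
  ⇒ a []           _ = []
  ⇒ a (x ∷ [])     _ = [-]
  ⇒ a (x ∷ y ∷ xs) t = let ≤ᵇ , t′ = to T-∧ t in ≤ᵇ⇒≤ _ _ ≤ᵇ ∷ ⇒ x (y ∷ xs) t′
  ⇐ : ∀ a xs → Linked _≤_ (gaps a xs) → T (sparse (a ∷ xs))
  ⇐ a []           _         = _
  ⇐ a (x ∷ [])     _         = _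
  ⇐ a (x ∷ y ∷ xs) (≤ ∷ Rxs) = from T-∧ (≤⇒≤ᵇ ≤ , ⇐ x (y ∷ xs) Rxs)

T-strongSchreier : ∀ ℓ {a xs} → T (strongSchreier ℓ (a ∷ xs)) ⇔ ℓ * length xs + 1 ≤ a
T-strongSchreier ℓ {a} {xs} rewrite *-suc ℓ (length xs) | m+n∸m≡n ℓ (ℓ * length xs) =
  mk⇔ (≤ᵇ⇒≤ _ _) ≤⇒≤ᵇ

lastTwoCond-fromGaps : ∀ n a gs g →
  lastTwoCond n (a ∷ fromGaps a (gs ∷ʳ g)) ≡ (suc n + (a + sum gs) ≡ᵇ 2 * (a + sum gs + g))
lastTwoCond-fromGaps n a []            g rewrite +-identityʳ a = refl
lastTwoCond-fromGaps n a (h ∷ [])      g rewrite +-identityʳ h = refl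
lastTwoCond-fromGaps n a (h ∷ h′ ∷ gs) g = trans
  (lastTwoCond-fromGaps n (a + h) (h′ ∷ gs) g)
  (cong (λ b → suc n + b ≡ᵇ 2 * (b + g)) (+-assoc a h (h′ + sum gs)))

record InF (n ℓ m : ℕ) (S : List ℕ) : Set where
  constructor inF⁺
  field
    two-elements : T (2 ≤ᵇ length S)
    sparse-A     : T (sparse (S ∷ʳ suc n))
    schreier-A   : T (strongSchreier ℓ (S ∷ʳ suc n))
    lastTwo      : T (lastTwoCond n S)
    length-A     : T (length (S ∷ʳ suc n) ≡ᵇ m)

T-inF : ∀ {n ℓ m S} → T (inF n ℓ m S) ⇔ InF n ℓ m S
T-inF {n} {ℓ} {m} {S} = mk⇔
  (λ t → let t₁ , t′ = to (T-∧ {2 ≤ᵇ length S}) t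
             t₂ , t″ = to (T-∧ {sparse A}) t′
             t₃ , t‴ = to (T-∧ {strongSchreier ℓ A}) t″
             t₄ , t₅ = to (T-∧ {lastTwoCond n S}) t‴
         in inF⁺ t₁ t₂ t₃ t₄ t₅)
  (λ (inF⁺ t₁ t₂ t₃ t₄ t₅) →
     from T-∧ (t₁ , from T-∧ (t₂ , from T-∧ (t₃ , from T-∧ (t₄ , t₅)))))
  where A = S ∷ʳ suc n

record IsPartition (n m k : ℕ) (P : List ℕ) : Set where
  constructor isPartition
  field
    descending : Linked _≥_ P
    parts-≥    : All (m ≤_) P
    sum-≡      : sum P ≡ n
    length-≡   : length P ≡ k

T-isPart : ∀ {n m k P} → T (isPart n m k P) ⇔ IsPartition n m k P
T-isPart = mk⇔ ⇒ ⇐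
  where
  ⇒ : _
  ⇒ t = let t₁ , t′ = to T-∧ t; t₂ , t″ = to T-∧ t′; t₃ , t₄ = to T-∧ t″ in
    isPartition (to T-nonincreasing t₁) (to T-allGeq t₂) (to T-≡ᵇ t₃) (to T-≡ᵇ t₄)
  ⇐ : _
  ⇐ (isPartition desc ≥m sum≡ len≡) = from T-∧ (from T-nonincreasing desc ,
    from T-∧ (from T-allGeq ≥m , from T-∧ (from T-≡ᵇ sum≡ , from T-≡ᵇ len≡)))

∈-Enlk⇔ : ∀ {n m k P} → 0 < m → P ∈ Enlk n m k ⇔ IsPartition n m k P
∈-Enlk⇔ {n} {m} {k} {P} 0<m = mk⇔
  (λ P∈ → to T-isPart (proj₂ (∈-filter⁻ isPart? {xs = tuples k (range1 n)} P∈)))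
  (λ π@(isPartition _ ≥m sum≡ len≡) → ∈-filter⁺ isPart?
    (subst (λ l → P ∈ tuples l (range1 n)) len≡ (∈-tuples (parts∈range1 ≥m sum≡)))
    (from T-isPart π))
  where
  isPart? = λ Q → T? (isPart n m k Q)
  parts∈range1 : All (m ≤_) P → sum P ≡ n → All (_∈ range1 n) P
  parts∈range1 ≥m refl = All.zipWith
    (λ (m≤x , x≤n) → ∈-range1⁺ (<-≤-trans 0<m m≤x) x≤n) (≥m , parts-≤-sum P)

Unique-Enlk : ∀ n m k → Unique (Enlk n m k)
Unique-Enlk n m k =
  Unique.filter⁺ (λ P → T? (isPart n m k P)) (Unique-tuples k (Unique-range1 n))

-- Sets whose two top gaps are equal

-- The set with minimum a whose gaps, read downwards from its maximum, are d followed by r.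
-- Adding n + 1 on top repeats the gap d (setOf-∷ʳ).
setOf : ℕ → ℕ → List ℕ → List ℕ
setOf a d r = a ∷ fromGaps a (reverse (d ∷ r))

length-setOf : ∀ a d r → length (setOf a d r) ≡ 2 + length r
length-setOf a d r =
  cong suc (trans (length-fromGaps a (reverse (d ∷ r))) (length-reverse (d ∷ r)))

length-setOf-∷ʳ : ∀ a d r x → length (setOf a d r ∷ʳ x) ≡ 3 + length r
length-setOf-∷ʳ a d r x = trans (length-++ (setOf a d r))
  (trans (cong (_+ 1) (length-setOf a d r)) (+-comm (2 + length r) 1))

module _ (n a d : ℕ) (r : List ℕ) where

  T-lastTwoCond-setOf : T (lastTwoCond n (setOf a d r)) ⇔ a + sum r + d + d ≡ suc n
  T-lastTwoCond-setOf
    rewrite unfold-reverse d r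
          | lastTwoCond-fromGaps n a (reverse r) d
          | sum-reverse r
    = midpoint⇔ (a + sum r) d (suc n) ⇔-∘ T-≡ᵇ

  setOf-∷ʳ : a + sum r + d + d ≡ suc n →
             setOf a d r ∷ʳ suc n ≡ a ∷ fromGaps a (reverse (d ∷ d ∷ r))
  setOf-∷ʳ top = cong (a ∷_) (sym (begin
    fromGaps a (reverse (d ∷ d ∷ r))       ≡⟨ cong (fromGaps a) (unfold-reverse d (d ∷ r)) ⟩
    fromGaps a (G ∷ʳ d)                    ≡⟨ fromGaps-∷ʳ a G d ⟩
    fromGaps a G ∷ʳ (a + sum G + d)        ≡⟨ cong (λ s → fromGaps a G ∷ʳ (a + s + d)) (sum-reverse (d ∷ r)) ⟩
    fromGaps a G ∷ʳ (a + (d + sum r) + d)  ≡⟨ cong (fromGaps a G ∷ʳ_) (trans (regroup a d (sum r)) top) ⟩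
    fromGaps a G ∷ʳ suc n                  ∎))
    where
    open ≡-Reasoning
    G = reverse (d ∷ r)
    regroup : ∀ a d s → a + (d + s) + d ≡ a + s + d + d
    regroup = solve-∀

record Admissible (n ℓ k a d : ℕ) (r : List ℕ) : Set where
  field
    descending    : Linked _≥_ (d ∷ d ∷ r)
    positive      : All (0 <_) (d ∷ r)
    minimum-large : ℓ * k + 1 ≤ a
    top-≡         : a + sum r + d + d ≡ suc n
    size-≡        : 2 + length r ≡ k

data AdmissibleImage (n ℓ k : ℕ) (f : ℕ → ℕ → List ℕ → List ℕ) : List ℕ → Set where
  image : ∀ {a d r} → Admissible n ℓ k a d r → AdmissibleImage n ℓ k f (f a d r)

module _ (n ℓ k : ℕ) {a d : ℕ} {r : List ℕ} where

  private
    G = reverse (d ∷ d ∷ r)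

  setOf-∈-Fnlk : Admissible n ℓ k a d r → setOf a d r ∈ Fnlk n ℓ (k + 1)
  setOf-∈-Fnlk adm = ∈-filter⁺ (λ S → T? (inF n ℓ (k + 1) S))
    (from (∈-sublists-range1⇔ n) (subst (Linked _<_ ∘ (0 ∷_)) (sym A≡) increasing))
    (from (T-inF {n} {ℓ} {k + 1} {setOf a d r}) (inF⁺ at-least-two sparse-A schreier-A
      (from (T-lastTwoCond-setOf n a d r) top-≡) (from T-≡ᵇ (trans length-A (+-comm 1 k)))))
    where
    open Admissible adm
    A≡ : setOf a d r ∷ʳ suc n ≡ a ∷ fromGaps a G
    A≡ = setOf-∷ʳ n a d r top-≡
    length-A : length (setOf a d r ∷ʳ suc n) ≡ suc k
    length-A = trans (length-setOf-∷ʳ a d r (suc n)) (cong suc size-≡)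
    increasing : Linked _<_ (0 ∷ a ∷ fromGaps a G)
    increasing = fromGaps-increasing 0
      (≤-trans (m≤n+m 1 (ℓ * k)) minimum-large ∷ All-reverse (All.head positive ∷ positive))
    at-least-two : T (2 ≤ᵇ length (setOf a d r))
    at-least-two = ≤⇒≤ᵇ (subst (2 ≤_) (sym (length-setOf a d r)) (m≤m+n 2 (length r)))
    sparse-A : T (sparse (setOf a d r ∷ʳ suc n))
    sparse-A = subst (T ∘ sparse) (sym A≡) (from (T-sparse {a} {fromGaps a G})
      (subst (Linked _≤_) (sym (gaps-fromGaps a G)) (Linked-reverse descending)))
    schreier-A : T (strongSchreier ℓ (setOf a d r ∷ʳ suc n))
    schreier-A = from (T-strongSchreier ℓ {a} {fromGaps a (reverse (d ∷ r)) ∷ʳ suc n})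
      (subst (λ m → ℓ * m + 1 ≤ a) (sym (suc-injective length-A)) minimum-large)

  setOf-admissible : All (0 <_) (d ∷ r) → T (inF n ℓ (k + 1) (setOf a d r)) → Admissible n ℓ k a d r
  setOf-admissible positive t = record
    { descending    = subst (Linked _≥_) (reverse-involutive (d ∷ d ∷ r)) (Linked-reverse ascending)
    ; positive      = positive
    ; minimum-large = subst (λ m → ℓ * m + 1 ≤ a) size (to (T-strongSchreier ℓ {a} {X ∷ʳ suc n}) schreier-A)
    ; top-≡         = top
    ; size-≡        = trans (sym (suc-injective (length-setOf-∷ʳ a d r (suc n)))) size
    }
    where
    open InF (to (T-inF {n} {ℓ} {k + 1} {setOf a d r}) t)
    X = fromGaps a (reverse (d ∷ r))
    top : a + sum r + d + d ≡ suc n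
    top = to (T-lastTwoCond-setOf n a d r) lastTwo
    size : length (X ∷ʳ suc n) ≡ k
    size = suc-injective (trans (to T-≡ᵇ length-A) (+-comm k 1))
    ascending : Linked _≤_ G
    ascending = subst (Linked _≤_) (gaps-fromGaps a G)
      (to (T-sparse {a} {fromGaps a G}) (subst (T ∘ sparse) (setOf-∷ʳ n a d r top) sparse-A))

setOf-shape : ∀ {a R} → Linked _<_ (a ∷ R) → 0 < length R →
  Σ ℕ λ d → Σ (List ℕ) λ r → All (0 <_) (d ∷ r) × a ∷ R ≡ setOf a d r
setOf-shape {a} {R} a<R 0<|R| = split (reverse (gaps a R)) R≡ (All-reverse (gaps-positive a<R))
  where
  R≡ : R ≡ fromGaps a (reverse (reverse (gaps a R)))
  R≡ = trans (sym (fromGaps-gaps (Linked.map <⇒≤ a<R))) (cong (fromGaps a) (sym (reverse-involutive _)))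
  split : ∀ L → R ≡ fromGaps a (reverse L) → All (0 <_) L →
          Σ ℕ λ d → Σ (List ℕ) λ r → All (0 <_) (d ∷ r) × a ∷ R ≡ setOf a d r
  split []      R≡[] _        = ⊥-elim (<-irrefl refl (subst (λ R → 0 < length R) R≡[] 0<|R|))
  split (d ∷ r) R≡′  positive = d , r , positive , cong (a ∷_) R≡′

∈-Fnlk⇒image : ∀ {n ℓ k S} → S ∈ Fnlk n ℓ (k + 1) → AdmissibleImage n ℓ k setOf S
∈-Fnlk⇒image {n} {ℓ} {k} {S} S∈
  with ∈-filter⁻ (λ S → T? (inF n ℓ (k + 1) S)) {xs = sublists (range1 n)} S∈
∈-Fnlk⇒image {n} {ℓ} {k} {[]} S∈ | _ , t =
  ⊥-elim (InF.two-elements (to (T-inF {n} {ℓ} {k + 1} {[]}) t))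
∈-Fnlk⇒image {n} {ℓ} {k} {S = a ∷ R} S∈ | S∈sub , t
  with setOf-shape (Linked-∷ʳ⁻ (Linked.tail (to (∈-sublists-range1⇔ n) S∈sub)))
                   (≤-pred (≤ᵇ⇒≤ 2 _ (InF.two-elements (to (T-inF {n} {ℓ} {k + 1} {a ∷ R}) t))))
... | d , r , positive , S≡ =
  subst (AdmissibleImage n ℓ k setOf) (sym S≡)
    (image (setOf-admissible n ℓ k positive (subst (T ∘ inF n ℓ (k + 1)) S≡ t)))

Unique-Fnlk : ∀ n ℓ m → Unique (Fnlk n ℓ m)
Unique-Fnlk n ℓ m = Unique.filter⁺ (λ S → T? (inF n ℓ m S)) (Unique-sublists (Unique-range1 n))

-- From sets to partitions and back

module _ (ℓ k : ℕ) where

  partitionOf : ℕ → ℕ → List ℕ → List ℕ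
  partitionOf a d r = a ∸ (ℓ * k + 1) + (ℓ + d) ∷ map (ℓ +_) (d ∷ r)

  toSet : List ℕ → List ℕ
  toSet (p ∷ t ∷ ts) = setOf (p ∸ t + (ℓ * k + 1)) (t ∸ ℓ) (map (_∸ ℓ) ts)
  toSet _            = []

  toPartition : List ℕ → List ℕ
  toPartition []      = []
  toPartition (a ∷ R) = fromReversedGaps (reverse (gaps a R))
    where
    fromReversedGaps : List ℕ → List ℕ
    fromReversedGaps []      = []
    fromReversedGaps (d ∷ r) = partitionOf a d r

  toPartition-setOf : ∀ a d r → toPartition (setOf a d r) ≡ partitionOf a d r
  toPartition-setOf a d r rewrite gaps-fromGaps a (reverse (d ∷ r)) | reverse-involutive (d ∷ r) = refl

  toSet-partitionOf : ∀ {a} d r → ℓ * k + 1 ≤ a → toSet (partitionOf a d r) ≡ setOf a d r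
  toSet-partitionOf {a} d r K≤a
    rewrite m+n∸n≡m (a ∸ (ℓ * k + 1)) (ℓ + d) | m∸n+n≡m K≤a | m+n∸m≡n ℓ d | map-∸-+ ℓ r = refl

  partitionOf-toSet : ∀ {p t ts} → t ≤ p → ℓ ≤ t → All (ℓ ≤_) ts →
    partitionOf (p ∸ t + (ℓ * k + 1)) (t ∸ ℓ) (map (_∸ ℓ) ts) ≡ p ∷ t ∷ ts
  partitionOf-toSet {p} {t} t≤p ℓ≤t ℓ≤ts
    rewrite m+n∸n≡m (p ∸ t) (ℓ * k + 1) | m+[n∸m]≡n ℓ≤t | m∸n+n≡m t≤p | map-+-∸ ℓ ℓ≤ts = refl

  sum-partitionOf : ∀ {a d r} → ℓ * k + 1 ≤ a → 2 + length r ≡ k →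
    suc (sum (partitionOf a d r)) ≡ a + sum r + d + d
  sum-partitionOf {a} {d} {r} K≤a refl = begin
    suc (y + (ℓ + d) + (ℓ + d + sum (map (ℓ +_) r)))       ≡⟨ cong (λ s → suc (y + (ℓ + d) + (ℓ + d + s))) (sum-map-+ ℓ r) ⟩
    suc (y + (ℓ + d) + (ℓ + d + (ℓ * length r + sum r)))   ≡⟨ regroup y ℓ d (length r) (sum r) ⟩
    y + (ℓ * (2 + length r) + 1) + sum r + d + d           ≡⟨ cong (λ b → b + sum r + d + d) (m∸n+n≡m K≤a) ⟩
    a + sum r + d + d                                      ∎
    where
    open ≡-Reasoning
    y = a ∸ (ℓ * (2 + length r) + 1)
    regroup : ∀ y ℓ d m s →
              suc (y + (ℓ + d) + (ℓ + d + (ℓ * m + s))) ≡ y + (ℓ * (2 + m) + 1) + s + d + d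
    regroup = solve-∀

module _ {n ℓ k a d : ℕ} {r : List ℕ} where

  partitionOf-isPartition : Admissible n ℓ k a d r → IsPartition n (ℓ + 1) k (partitionOf ℓ k a d r)
  partitionOf-isPartition adm = isPartition
    (m≤n+m (ℓ + d) (a ∸ (ℓ * k + 1)) ∷
       Linkedₚ.map⁺ (Linked.map (+-monoʳ-≤ ℓ) (Linked.tail descending)))
    (≤-trans (All.head parts) (m≤n+m (ℓ + d) (a ∸ (ℓ * k + 1))) ∷ parts)
    (suc-injective (trans (sum-partitionOf ℓ k {a} {d} {r} minimum-large size-≡) top-≡))
    (trans (cong (2 +_) (length-map (ℓ +_) r)) size-≡)
    where
    open Admissible adm
    parts : All (ℓ + 1 ≤_) (map (ℓ +_) (d ∷ r))
    parts = All.map⁺ (All.map (+-monoʳ-≤ ℓ) positive)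

  partitionOf-admissible : ℓ * k + 1 ≤ a → IsPartition n (ℓ + 1) k (partitionOf ℓ k a d r) →
                           Admissible n ℓ k a d r
  partitionOf-admissible K≤a (isPartition descending parts sum≡ length≡) = record
    { descending    = ≤-refl ∷ Linked.map (+-cancelˡ-≤ ℓ _ _) (Linkedₚ.map⁻ (Linked.tail descending))
    ; positive      = All.map (+-cancelˡ-≤ ℓ 1 _) (All.map⁻ (All.tail parts))
    ; minimum-large = K≤a
    ; top-≡         = trans (sym (sum-partitionOf ℓ k {a} {d} {r} K≤a size)) (cong suc sum≡)
    ; size-≡        = size
    }
    where
    size : 2 + length r ≡ k
    size = trans (cong (2 +_) (sym (length-map (ℓ +_) r))) length≡

isPartition⇒image : ∀ {n ℓ k P} → 2 ≤ k → IsPartition n (ℓ + 1) k P →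
                    AdmissibleImage n ℓ k (partitionOf ℓ k) P
isPartition⇒image {P = []}    2≤k (isPartition _ _ _ refl) = ⊥-elim (<⇒≱ 2≤k z≤n)
isPartition⇒image {P = _ ∷ []} 2≤k (isPartition _ _ _ refl) = ⊥-elim (<⇒≱ 2≤k (s≤s z≤n))
isPartition⇒image {n} {ℓ} {k} {p ∷ t ∷ ts} _ π@(isPartition (t≤p ∷ _) (_ ∷ ℓ<t ∷ ℓ<ts) _ _) =
  subst (AdmissibleImage n ℓ k (partitionOf ℓ k)) P≡
    (image (partitionOf-admissible (m≤n+m _ (p ∸ t)) (subst (IsPartition n (ℓ + 1) k) (sym P≡) π)))
  where
  ℓ≤ : ∀ {x} → ℓ + 1 ≤ x → ℓ ≤ x
  ℓ≤ = ≤-trans (m≤m+n ℓ 1)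
  P≡ : partitionOf ℓ k (p ∸ t + (ℓ * k + 1)) (t ∸ ℓ) (map (_∸ ℓ) ts) ≡ p ∷ t ∷ ts
  P≡ = partitionOf-toSet ℓ k t≤p (ℓ≤ ℓ<t) (All.map ℓ≤ ℓ<ts)

module Bijection {n ℓ k : ℕ} (2≤k : 2 ≤ k) where

  private
    E = Enlk n (ℓ + 1) k
    F = Fnlk n ℓ (k + 1)

    E-image : ∀ {P} → P ∈ E → AdmissibleImage n ℓ k (partitionOf ℓ k) P
    E-image P∈ = isPartition⇒image 2≤k (to (∈-Enlk⇔ {n} {ℓ + 1} {k} (m≤n+m 1 ℓ)) P∈)

  toSet-∈ : ∀ {P} → P ∈ E → toSet ℓ k P ∈ F
  toSet-∈ P∈ with E-image P∈
  ... | image {a} {d} {r} adm =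
    subst (_∈ F) (sym (toSet-partitionOf ℓ k d r (Admissible.minimum-large adm))) (setOf-∈-Fnlk n ℓ k adm)

  toPartition-∈ : ∀ {S} → S ∈ F → toPartition ℓ k S ∈ E
  toPartition-∈ S∈ with ∈-Fnlk⇒image {n} {ℓ} {k} S∈
  ... | image {a} {d} {r} adm =
    subst (_∈ E) (sym (toPartition-setOf ℓ k a d r))
      (from (∈-Enlk⇔ {n} {ℓ + 1} {k} (m≤n+m 1 ℓ)) (partitionOf-isPartition adm))

  toPartition-toSet : ∀ {P} → P ∈ E → toPartition ℓ k (toSet ℓ k P) ≡ P
  toPartition-toSet P∈ with E-image P∈
  ... | image {a} {d} {r} adm = trans
    (cong (toPartition ℓ k) (toSet-partitionOf ℓ k d r (Admissible.minimum-large adm)))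
    (toPartition-setOf ℓ k a d r)

  toSet-toPartition : ∀ {S} → S ∈ F → toSet ℓ k (toPartition ℓ k S) ≡ S
  toSet-toPartition S∈ with ∈-Fnlk⇒image {n} {ℓ} {k} S∈
  ... | image {a} {d} {r} adm = trans
    (cong (toSet ℓ k) (toPartition-setOf ℓ k a d r))
    (toSet-partitionOf ℓ k d r (Admissible.minimum-large adm))

corollary2p3 : (ℓ n k : ℕ) → ℓ + 1 ≤ n → 2 ≤ k →
    length (Enlk n (ℓ + 1) k) ≡ length (Fnlk n ℓ (k + 1))
corollary2p3 ℓ n k _ 2≤k =
  length-≡-by-inverses (Unique-Enlk n (ℓ + 1) k) (Unique-Fnlk n ℓ (k + 1)) (toSet ℓ k) (toPartition ℓ k)
    toSet-∈ toPartition-∈ toPartition-toSet toSet-toPartition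
  where open Bijection {n} {ℓ} {k} 2≤k
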